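{- Assume the $abc$ conjecture holds: for every $\varepsilon>0$ there are only finitely many triples $(a,b,c)$ of pairwise coprime positive integers with $a+b=c$ and $c>\operatorname{rad}(abc)^{1+\varepsilon}$. Then for every $\varepsilon>0$ there exists an integer $j_\varepsilon$ (depending only on $\varepsilon$) such that for every integer $j\geq j_\varepsilon$ and every $n\in\mathcal{N}(j)$, $$ n \geq \frac{1}{6}\, 2^{(1-\rho\varepsilon)j} - 1, \qquad \rho=\log_2 3.$$
   Context: $\operatorname{rad}(m)$ denotes the product of the distinct prime factors of a positive integer $m$. The Collatz map is $T(n)=(3n+1)/2$ if $n$ is odd and $T(n)=n/2$ if $n$ is even, with $T^0(n)=n$ and $T^{i}$ the $i$-th iterate. For an integer $j\geq 2$, $\mathcal{N}(j)$ is the set of positive integers $n<2^j$ such that among the $j$ terms $n, T(n),\ldots,T^{j-1}(n)$ exactly one is even.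
   Formalization: The parameter ε ranges over the positive rationals. -}

module Defs where

open import Data.Nat using (ℕ; zero; suc; _+_; _*_; _^_; _≤_; _<_; _≥_; _%_; ⌊_/2⌋; _≟_)
open import Data.Nat.Divisibility using (_∣_; _∣?_)
open import Data.Nat.Primality using (Prime; prime?)
open import Data.Nat.Coprimality using (Coprime)
open import Data.List using (List; filter; upTo; length; map)
open import Data.Nat.ListAction using (product)
open import Data.List.Membership.Propositional using (_∈_)
open import Data.Product using (_×_; _,_; ∃-syntax)
open import Relation.Nullary.Decidable using (_×-dec_)
open import Relation.Binary.PropositionalEquality using (_≡_)
open import Function using (_∘_)

rad : ℕ → ℕ
rad m = product (filter (λ p → prime? p ×-dec (p ∣? m)) (upTo (suc m)))

T : ℕ → ℕ
T n with n % 2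
... | zero  = ⌊ n /2⌋
... | suc _ = ⌊ (3 * n + 1) /2⌋

iter : ℕ → ℕ → ℕ
iter zero    n = n
iter (suc i) n = T (iter i n)

evenCount : ℕ → ℕ → ℕ
evenCount j n = length (filter (λ i → iter i n % 2 ≟ 0) (upTo j))

InN : ℕ → ℕ → Set
InN j n = (0 < n) × (n < 2 ^ j) × (evenCount j n ≡ 1)

-- abc conjecture, with ε = p/q a positive rational:
-- c > rad(abc)^{1+p/q}  ⇔  c^q > rad(abc)^{q+p};
-- "finitely many triples" = all of them occur in some finite list.
ABC : Set
ABC = ∀ (p q : ℕ) → 1 ≤ p → 1 ≤ q →
      ∃[ L ] (∀ (a b c : ℕ) → 0 < a → 0 < b → 0 < c →
              Coprime a b → Coprime a c → Coprime b c →
              a + b ≡ c → rad (a * b * c) ^ (q + p) < c ^ q →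
              (a , b , c) ∈ L)

-- Let a be the position of the unique even term among n, T n, …, T^(j-1) n, and j = a + 1 + b.
-- The a odd steps before it give n + 1 = 2^a u and T^a n + 1 = 3^a u; the b odd steps after it
-- give 3^a u + 1 = 2^(b+1) w. So (3^a u, 1, c = 3^a u + 1) is a coprime triple with radical
-- dividing 6uw, and 2^j ≤ c², c ≤ 3^j. The finitely many exceptional triples all have c ≤ S,
-- which is impossible once j ≥ S². Otherwise c^q ≤ (6uw)^(q+p), and since 6uw · 2^b = 3u · c
-- this forces 2^(bq) ≤ (3u)^q c^p, which multiplied by 2^((a+1)q) is the claimed bound.

module Submission where

open import Defs
open import Data.Nat
open import Data.Nat.Properties
open import Data.Nat.Divisibility
open import Data.Nat.Primality
open import Data.Nat.Primality.Factorisation using (factorisationHasAllPrimeFactors)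
open import Data.Nat.Coprimality as Coprimality using (Coprime; coprime-+; 1-coprimeTo; coprime-divisor)
open import Data.Nat.ListAction using (sum; product)
open import Data.Nat.Tactic.RingSolver using (solve-∀)
open import Data.List using ([]; _∷_; filter; upTo; length; map)
open import Data.List.Membership.Propositional using (_∈_)
open import Data.List.Membership.Propositional.Properties
  using (∈-filter⁺; ∈-filter⁻; ∈-upTo⁺; ∈-upTo⁻; ∈-map⁺)
open import Data.List.Relation.Unary.All as All using (All; []; _∷_)
import Data.List.Relation.Unary.All.Properties as All
open import Data.List.Relation.Unary.AllPairs using ([]; _∷_)
import Data.List.Relation.Unary.AllPairs.Properties as AllPairs
open import Data.List.Relation.Unary.Any using (here; there)
open import Data.List.Relation.Unary.Unique.Propositional using (Unique)
open import Data.List.Relation.Unary.Unique.Propositional.Properties using (upTo⁺)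
open import Data.Product using (∃-syntax; _×_; _,_; proj₁; proj₂)
open import Data.Sum using (_⊎_; inj₁; inj₂)
open import Function using (_∘_)
open import Relation.Nullary using (yes; no; contradiction)
open import Relation.Nullary.Decidable using (_×-dec_)
open import Relation.Unary using (Pred; Decidable)
open import Relation.Binary.PropositionalEquality

Odd : ℕ → Set
Odd x = x % 2 ≢ 0

even-or-odd : ∀ x → (∃[ t ] x ≡ t + t) ⊎ (∃[ t ] x ≡ suc (t + t))
even-or-odd zero = inj₁ (0 , refl)
even-or-odd (suc x) with even-or-odd x
... | inj₁ (t , refl) = inj₂ (t , refl)
... | inj₂ (t , refl) = inj₁ (suc t , cong suc (sym (+-suc t t)))

[t+t]%2≡0 : ∀ t → (t + t) % 2 ≡ 0
[t+t]%2≡0 zero = refl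
[t+t]%2≡0 (suc t) rewrite +-suc t t = [t+t]%2≡0 t

[1+t+t]%2≡1 : ∀ t → suc (t + t) % 2 ≡ 1
[1+t+t]%2≡1 zero = refl
[1+t+t]%2≡1 (suc t) rewrite +-suc t t = [1+t+t]%2≡1 t

even⇒double : ∀ x → x % 2 ≡ 0 → ∃[ t ] x ≡ t + t
even⇒double x x%2≡0 with even-or-odd x
... | inj₁ x≡t+t = x≡t+t
... | inj₂ (t , refl) = contradiction (trans (sym ([1+t+t]%2≡1 t)) x%2≡0) λ ()

odd⇒double+1 : ∀ x → Odd x → ∃[ t ] x ≡ suc (t + t)
odd⇒double+1 x odd with even-or-odd x
... | inj₁ (t , refl) = contradiction ([t+t]%2≡0 t) odd
... | inj₂ x≡1+t+t = x≡1+t+t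

T-double : ∀ t → T (t + t) ≡ t
T-double t rewrite [t+t]%2≡0 t = sym (n≡⌊n+n/2⌋ t)

T-double+1 : ∀ t → T (suc (t + t)) + 1 ≡ 3 * (t + 1)
T-double+1 t rewrite [1+t+t]%2≡1 t = begin
  ⌊ 3 * suc (t + t) + 1 /2⌋ + 1       ≡⟨ cong (λ m → ⌊ m /2⌋ + 1) (3[1+t+t]+1 t) ⟩
  ⌊ (3 * t + 2) + (3 * t + 2) /2⌋ + 1 ≡⟨ cong (_+ 1) (n≡⌊n+n/2⌋ (3 * t + 2)) ⟨
  3 * t + 2 + 1                       ≡⟨ 3t+2+1 t ⟩
  3 * (t + 1)                         ∎
  where
  open ≡-Reasoning
  3[1+t+t]+1 : ∀ t → 3 * suc (t + t) + 1 ≡ (3 * t + 2) + (3 * t + 2)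
  3[1+t+t]+1 = solve-∀
  3t+2+1 : ∀ t → 3 * t + 2 + 1 ≡ 3 * (t + 1)
  3t+2+1 = solve-∀

iter-+ : ∀ i s n → iter (i + s) n ≡ iter i (iter s n)
iter-+ zero    s n = refl
iter-+ (suc i) s n = cong T (iter-+ i s n)

prime∣^⇒∣ : ∀ {p} m k → Prime p → p ∣ m ^ k → p ∣ m
prime∣^⇒∣ m zero    pp p∣1 = contradiction (subst Prime (∣1⇒≡1 p∣1) pp) ¬prime[1]
prime∣^⇒∣ m (suc k) pp p∣m^k+1 with euclidsLemma m (m ^ k) pp p∣m^k+1
... | inj₁ p∣m   = p∣m
... | inj₂ p∣m^k = prime∣^⇒∣ m k pp p∣m^k

prime∣m^k*n⇒∣m*n : ∀ {p} m k n → Prime p → p ∣ m ^ k * n → p ∣ m * n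
prime∣m^k*n⇒∣m*n m k n pp p∣m^k*n with euclidsLemma (m ^ k) n pp p∣m^k*n
... | inj₁ p∣m^k = ∣m⇒∣m*n n (prime∣^⇒∣ m k pp p∣m^k)
... | inj₂ p∣n   = ∣n⇒∣m*n m p∣n

2∤3^k : ∀ k → 2 ∤ 3 ^ k
2∤3^k k 2∣3^k with n∣m⇒m%n≡0 3 2 (prime∣^⇒∣ 3 k prime[2] 2∣3^k)
... | ()

prime∤⇒coprime : ∀ {p n} → Prime p → p ∤ n → Coprime p n
prime∤⇒coprime pp p∤n (d∣p , d∣n) with prime⇒irreducible pp d∣p
... | inj₁ d≡1 = d≡1
... | inj₂ refl = contradiction d∣n p∤n

coprime-product-of-other-primes : ∀ {p ps} → Prime p → All Prime ps → All (p ≢_) ps →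
                                  Coprime p (product ps)
coprime-product-of-other-primes pp pps p∉ps = prime∤⇒coprime pp λ p∣Πps →
  All.lookup p∉ps (factorisationHasAllPrimeFactors pp p∣Πps pps) refl

distinct-primes-product∣ : ∀ {d ps} → All Prime ps → Unique ps → All (_∣ d) ps → product ps ∣ d
distinct-primes-product∣ {d} []                 []              []            = 1∣ d
distinct-primes-product∣ {d} {p ∷ ps} (pp ∷ pps) (p∉ps ∷ unique) (p∣d ∷ ps∣d)
  with divides k d≡k*Πps ← distinct-primes-product∣ pps unique ps∣d
  with divides l refl ← coprime-divisor (coprime-product-of-other-primes pp pps p∉ps)
                          (subst (p ∣_) (trans d≡k*Πps (*-comm k _)) p∣d)
  = divides l (trans d≡k*Πps (*-assoc l p (product ps)))

rad∣ : ∀ m d → (∀ {p} → Prime p → p ∣ m → p ∣ d) → rad m ∣ d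
rad∣ m d prime-divisors∣d =
  distinct-primes-product∣ (All.map proj₁ prime-divisors)
                           (AllPairs.filter⁺ primeDivisor? (upTo⁺ (suc m)))
                           (All.map (λ (pp , p∣m) → prime-divisors∣d pp p∣m) prime-divisors)
  where
  primeDivisor? = λ p → prime? p ×-dec (p ∣? m)
  prime-divisors = All.all-filter primeDivisor? (upTo (suc m))

-- Since 2 ∤ 3^k, the evenness of x + 1 = 3^k w passes to w.
odd-step : ∀ k w x → Odd x → x + 1 ≡ 3 ^ k * w →
           ∃[ w′ ] (w ≡ w′ * 2 × T x + 1 ≡ 3 ^ suc k * w′)
odd-step k w x odd x+1≡3^k*w with t , refl ← odd⇒double+1 x odd = w′ , w≡w′*2 , T-x+1
  where
  open ≡-Reasoning
  3^k*w≡[t+1]*2 : 3 ^ k * w ≡ (t + 1) * 2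
  3^k*w≡[t+1]*2 = trans (sym x+1≡3^k*w) (1+t+t+1 t)
    where
    1+t+t+1 : ∀ t → suc (t + t) + 1 ≡ (t + 1) * 2
    1+t+t+1 = solve-∀
  2∣w : 2 ∣ w
  2∣w with euclidsLemma (3 ^ k) w prime[2] (divides (t + 1) 3^k*w≡[t+1]*2)
  ... | inj₁ 2∣3^k = contradiction 2∣3^k (2∤3^k k)
  ... | inj₂ 2∣w   = 2∣w
  w′ = quotient 2∣w
  w≡w′*2 : w ≡ w′ * 2
  w≡w′*2 = _∣_.equality 2∣w
  t+1≡3^k*w′ : t + 1 ≡ 3 ^ k * w′
  t+1≡3^k*w′ = *-cancelʳ-≡ (t + 1) (3 ^ k * w′) 2 (begin
    (t + 1) * 2      ≡⟨ 3^k*w≡[t+1]*2 ⟨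
    3 ^ k * w        ≡⟨ cong (3 ^ k *_) w≡w′*2 ⟩
    3 ^ k * (w′ * 2) ≡⟨ *-assoc (3 ^ k) w′ 2 ⟨
    3 ^ k * w′ * 2   ∎)
  T-x+1 : T (suc (t + t)) + 1 ≡ 3 ^ suc k * w′
  T-x+1 = begin
    T (suc (t + t)) + 1 ≡⟨ T-double+1 t ⟩
    3 * (t + 1)         ≡⟨ cong (3 *_) t+1≡3^k*w′ ⟩
    3 * (3 ^ k * w′)    ≡⟨ *-assoc 3 (3 ^ k) w′ ⟨
    3 ^ suc k * w′      ∎

odd-run : ∀ k y → (∀ {i} → i < k → Odd (iter i y)) →
          ∃[ w ] (y + 1 ≡ 2 ^ k * w × iter k y + 1 ≡ 3 ^ k * w)
odd-run zero    y _   = y + 1 , sym (*-identityˡ _) , sym (*-identityˡ _)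
odd-run (suc k) y odd
  with w , y+1≡2^k*w , iter+1≡3^k*w ← odd-run k y (odd ∘ m<n⇒m<1+n)
  with w′ , refl , T-iter+1≡3^[1+k]*w′ ← odd-step k w (iter k y) (odd ≤-refl) iter+1≡3^k*w
  = w′ , trans y+1≡2^k*w (regroup (2 ^ k) w′) , T-iter+1≡3^[1+k]*w′
  where
  regroup : ∀ a w′ → a * (w′ * 2) ≡ 2 * a * w′
  regroup = solve-∀

module _ {p} {P : Pred ℕ p} (P? : Decidable P) where

  unique-below : ∀ {j} → length (filter P? (upTo j)) ≡ 1 →
                 ∃[ a ] (a < j × P a × (∀ {i} → i < j → P i → i ≡ a))
  unique-below {j} len with filter P? (upTo j) in eq
  unique-below {j} len | a ∷ [] =
    let a∈upTo , Pa = ∈-filter⁻ P? (subst (a ∈_) (sym eq) (here refl))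
    in a , ∈-upTo⁻ a∈upTo , Pa , only
    where
    only : ∀ {i} → i < j → P i → i ≡ a
    only i<j Pi with subst (_ ∈_) eq (∈-filter⁺ P? (∈-upTo⁺ i<j) Pi)
    ... | here i≡a = i≡a

OddExcept : ℕ → ℕ → ℕ → Set
OddExcept j a n = ∀ {i} → i < j → i ≢ a → Odd (iter i n)

unique-even-index : ∀ {j n} → evenCount j n ≡ 1 →
                    ∃[ a ] (a < j × iter a n % 2 ≡ 0 × OddExcept j a n)
unique-even-index {j} {n} one-even
  with a , a<j , iterₐ-even , only-even ← unique-below (λ i → iter i n % 2 ≟ 0) one-even
  = a , a<j , iterₐ-even , λ i<j i≢a iterᵢ-even → i≢a (only-even i<j iterᵢ-even)

odd-before : ∀ {j a n} → a < j → OddExcept j a n → ∀ {i} → i < a → Odd (iter i n)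
odd-before a<j odd i<a = odd (<-trans i<a a<j) (<⇒≢ i<a)

odd-after : ∀ {j a n} → a < j → OddExcept j a n →
            ∀ {i} → i < j ∸ suc a → Odd (iter i (iter (suc a) n))
odd-after {j} {a} {n} a<j odd {i} i<b = subst Odd (iter-+ i (suc a) n)
  (odd (subst (i + suc a <_) (m∸n+n≡m a<j) (+-monoˡ-< (suc a) i<b)) (>⇒≢ a<i+1+a))
  where
  a<i+1+a : a < i + suc a
  a<i+1+a = subst (a <_) (sym (+-suc i a)) (s≤s (m≤n+m a i))

record TwoOddRuns (j n : ℕ) : Set where
  field
    a b u w           : ℕ
    j≡1+a+b           : j ≡ suc a + b
    n+1≡2^a*u         : n + 1 ≡ 2 ^ a * u
    3^a*u+1≡2^[1+b]*w : 3 ^ a * u + 1 ≡ 2 ^ suc b * w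

InN⇒TwoOddRuns : ∀ {j n} → InN j n → TwoOddRuns j n
InN⇒TwoOddRuns {j} {n} (_ , _ , one-even)
  with a , a<j , iterₐ-even , odd ← unique-even-index one-even
  with u , n+1≡2^a*u , iterₐ+1≡3^a*u ← odd-run a n (odd-before a<j odd)
  with t , iterₐ≡t+t ← even⇒double (iter a n) iterₐ-even
  with w , iterₐ₊₁+1≡2^b*w , _ ← odd-run (j ∸ suc a) (iter (suc a) n) (odd-after a<j odd)
  = record { a = a ; b = b ; u = u ; w = w
           ; j≡1+a+b = sym (m+[n∸m]≡n a<j)
           ; n+1≡2^a*u = n+1≡2^a*u
           ; 3^a*u+1≡2^[1+b]*w = 3^a*u+1≡2^[1+b]*w
           }
  where
  open ≡-Reasoning
  b = j ∸ suc a
  iterₐ₊₁≡t : iter (suc a) n ≡ t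
  iterₐ₊₁≡t = trans (cong T iterₐ≡t+t) (T-double t)
  t+t+1+1 : ∀ t → t + t + 1 + 1 ≡ 2 * (t + 1)
  t+t+1+1 = solve-∀
  3^a*u+1≡2^[1+b]*w : 3 ^ a * u + 1 ≡ 2 ^ suc b * w
  3^a*u+1≡2^[1+b]*w = begin
    3 ^ a * u + 1            ≡⟨ cong (_+ 1) iterₐ+1≡3^a*u ⟨
    iter a n + 1 + 1         ≡⟨ cong (λ x → x + 1 + 1) iterₐ≡t+t ⟩
    t + t + 1 + 1            ≡⟨ t+t+1+1 t ⟩
    2 * (t + 1)              ≡⟨ cong (λ x → 2 * (x + 1)) iterₐ₊₁≡t ⟨
    2 * (iter (suc a) n + 1) ≡⟨ cong (2 *_) iterₐ₊₁+1≡2^b*w ⟩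
    2 * (2 ^ b * w)          ≡⟨ *-assoc 2 (2 ^ b) w ⟨
    2 ^ suc b * w            ∎

^-distribʳ-* : ∀ m n o → (m * n) ^ o ≡ m ^ o * n ^ o
^-distribʳ-* m n zero    = refl
^-distribʳ-* m n (suc o) = begin
  m * n * (m * n) ^ o       ≡⟨ cong (m * n *_) (^-distribʳ-* m n o) ⟩
  m * n * (m ^ o * n ^ o)   ≡⟨ interchange m n (m ^ o) (n ^ o) ⟩
  m * m ^ o * (n * n ^ o)   ∎
  where
  open ≡-Reasoning
  interchange : ∀ m n x y → m * n * (x * y) ≡ m * x * (n * y)
  interchange = solve-∀

c^q≤D^[q+p]⇒B^q≤U^q*c^p : ∀ p q {B U c D} .{{_ : NonZero U}} .{{_ : NonZero c}} →
                           c ^ q ≤ D ^ (q + p) → D * B ≡ U * c → B ^ q ≤ U ^ q * c ^ p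
c^q≤D^[q+p]⇒B^q≤U^q*c^p p q {B} {U} {c} {D} c^q≤D^[q+p] D*B≡U*c with B ≤? U
... | yes B≤U = begin
  B ^ q         ≤⟨ ^-monoˡ-≤ q B≤U ⟩
  U ^ q         ≤⟨ m≤m*n (U ^ q) (c ^ p) {{m^n≢0 c p}} ⟩
  U ^ q * c ^ p ∎
  where open ≤-Reasoning
... | no B≰U = *-cancelʳ-≤ (B ^ q) (U ^ q * c ^ p) (U ^ p) {{m^n≢0 U p}} (begin
  B ^ q * U ^ p         ≤⟨ *-monoʳ-≤ (B ^ q) (^-monoˡ-≤ p (<⇒≤ (≰⇒> B≰U))) ⟩
  B ^ q * B ^ p         ≡⟨ ^-distribˡ-+-* B q p ⟨
  B ^ (q + p)           ≤⟨ B^[q+p]≤U^[q+p]*c^p ⟩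
  U ^ (q + p) * c ^ p   ≡⟨ cong (_* c ^ p) (^-distribˡ-+-* U q p) ⟩
  U ^ q * U ^ p * c ^ p ≡⟨ swapʳ (U ^ q) (U ^ p) (c ^ p) ⟩
  U ^ q * c ^ p * U ^ p ∎)
  where
  open ≤-Reasoning
  swapʳ : ∀ x y z → x * y * z ≡ x * z * y
  swapʳ = solve-∀
  reassoc : ∀ x y z → x * (y * z) ≡ y * (x * z)
  reassoc = solve-∀
  B^[q+p]≤U^[q+p]*c^p : B ^ (q + p) ≤ U ^ (q + p) * c ^ p
  B^[q+p]≤U^[q+p]*c^p = *-cancelˡ-≤ (c ^ q) {{m^n≢0 c q}} (begin
    c ^ q * B ^ (q + p)           ≤⟨ *-monoˡ-≤ (B ^ (q + p)) c^q≤D^[q+p] ⟩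
    D ^ (q + p) * B ^ (q + p)     ≡⟨ ^-distribʳ-* D B (q + p) ⟨
    (D * B) ^ (q + p)             ≡⟨ cong (_^ (q + p)) D*B≡U*c ⟩
    (U * c) ^ (q + p)             ≡⟨ ^-distribʳ-* U c (q + p) ⟩
    U ^ (q + p) * c ^ (q + p)     ≡⟨ cong (U ^ (q + p) *_) (^-distribˡ-+-* c q p) ⟩
    U ^ (q + p) * (c ^ q * c ^ p) ≡⟨ reassoc (U ^ (q + p)) (c ^ q) (c ^ p) ⟩
    c ^ q * (U ^ (q + p) * c ^ p) ∎)

n<2^n : ∀ n → n < 2 ^ n
n<2^n zero    = s≤s z≤n
n<2^n (suc n) = begin-strict
  suc n         ≤⟨ n<2^n n ⟩
  2 ^ n         <⟨ m<m+n (2 ^ n) (m^n>0 2 n) ⟩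
  2 ^ n + 2 ^ n ≡⟨ cong (2 ^ n +_) (+-identityʳ (2 ^ n)) ⟨
  2 ^ suc n     ∎
  where open ≤-Reasoning

module OddRunsBound {j n} (runs : TwoOddRuns j n) (n<2^j : n < 2 ^ j) where
  open TwoOddRuns runs

  X c D : ℕ
  X = 3 ^ a * u
  c = X + 1
  D = 3 * u * (2 * w)

  instance
    u≢0 : NonZero u
    u≢0 with u | n+1≡2^a*u
    ... | zero  | n+1≡0 = contradiction (trans (+-comm 1 n) (trans n+1≡0 (*-zeroʳ (2 ^ a)))) λ ()
    ... | suc _ | _     = _

    w≢0 : NonZero w
    w≢0 with w | 3^a*u+1≡2^[1+b]*w
    ... | zero  | c≡0 = contradiction (trans (+-comm 1 X) (trans c≡0 (*-zeroʳ (2 ^ suc b)))) λ ()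
    ... | suc _ | _   = _

    c≢0 : NonZero c
    c≢0 = >-nonZero (subst (0 <_) (+-comm 1 X) z<s)

    3u≢0 : NonZero (3 * u)
    3u≢0 = m*n≢0 3 u

    D≢0 : NonZero D
    D≢0 = m*n≢0 (3 * u) (2 * w) {{3u≢0}} {{m*n≢0 2 w}}

  0<X : 0 < X
  0<X = >-nonZero⁻¹ X {{m*n≢0 (3 ^ a) u {{m^n≢0 3 a}}}}

  0<c : 0 < c
  0<c = >-nonZero⁻¹ c

  2^j≡2^a*2^[1+b] : 2 ^ j ≡ 2 ^ a * 2 ^ suc b
  2^j≡2^a*2^[1+b] = trans (cong (2 ^_) j≡1+a+b)
                          (trans (cong (2 *_) (^-distribˡ-+-* 2 a b)) (shuffle (2 ^ a) (2 ^ b)))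
    where
    shuffle : ∀ x y → 2 * (x * y) ≡ x * (2 * y)
    shuffle = solve-∀

  2^j≤c*c : 2 ^ j ≤ c * c
  2^j≤c*c = begin
    2 ^ j               ≡⟨ 2^j≡2^a*2^[1+b] ⟩
    2 ^ a * 2 ^ suc b   ≤⟨ *-mono-≤ 2^a≤c 2^[1+b]≤c ⟩
    c * c               ∎
    where
    open ≤-Reasoning
    2^a≤c : 2 ^ a ≤ c
    2^a≤c = begin
      2 ^ a ≤⟨ ^-monoˡ-≤ a (s≤s (s≤s z≤n)) ⟩
      3 ^ a ≤⟨ m≤m*n (3 ^ a) u  ⟩
      X     ≤⟨ m≤m+n X 1 ⟩
      c     ∎
    2^[1+b]≤c : 2 ^ suc b ≤ c
    2^[1+b]≤c = subst (2 ^ suc b ≤_) (sym 3^a*u+1≡2^[1+b]*w) (m≤m*n (2 ^ suc b) w )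

  S*S≤j⇒S<c : ∀ S → S * S ≤ j → S < c
  S*S≤j⇒S<c S S*S≤j = ≰⇒> λ c≤S → <-irrefl refl (begin-strict
    j     <⟨ n<2^n j ⟩
    2 ^ j ≤⟨ 2^j≤c*c ⟩
    c * c ≤⟨ *-mono-≤ c≤S c≤S ⟩
    S * S ≤⟨ S*S≤j ⟩
    j     ∎)
    where open ≤-Reasoning

  c≤3^j : c ≤ 3 ^ j
  c≤3^j = begin
    3 ^ a * u + 1       ≤⟨ +-monoʳ-≤ X (m^n>0 3 a) ⟩
    3 ^ a * u + 3 ^ a   ≡⟨ cong (X +_) (*-identityʳ (3 ^ a)) ⟨
    3 ^ a * u + 3 ^ a * 1 ≡⟨ *-distribˡ-+ (3 ^ a) u 1 ⟨
    3 ^ a * (u + 1)     ≤⟨ *-monoʳ-≤ (3 ^ a) (subst (_≤ 3 ^ suc b) (+-comm 1 u) u<3^[1+b]) ⟩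
    3 ^ a * 3 ^ suc b   ≡⟨ ^-distribˡ-+-* 3 a (suc b) ⟨
    3 ^ (a + suc b)     ≡⟨ cong (3 ^_) (trans (+-suc a b) (sym j≡1+a+b)) ⟩
    3 ^ j               ∎
    where
    open ≤-Reasoning
    u≤2^[1+b] : u ≤ 2 ^ suc b
    u≤2^[1+b] = *-cancelˡ-≤ (2 ^ a) {{m^n≢0 2 a}} (begin
      2 ^ a * u         ≡⟨ n+1≡2^a*u ⟨
      n + 1             ≡⟨ +-comm n 1 ⟩
      suc n             ≤⟨ n<2^j ⟩
      2 ^ j             ≡⟨ 2^j≡2^a*2^[1+b] ⟩
      2 ^ a * 2 ^ suc b ∎)
    u<3^[1+b] : u < 3 ^ suc b
    u<3^[1+b] = ≤-<-trans u≤2^[1+b] (^-monoˡ-< (suc b) (s≤s (s≤s (s≤s z≤n))))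

  rad∣D : rad (X * 1 * c) ∣ D
  rad∣D = rad∣ (X * 1 * c) D prime∣D
    where
    prime∣D : ∀ {p} → Prime p → p ∣ X * 1 * c → p ∣ D
    prime∣D {p} pp p∣X*1*c with euclidsLemma (X * 1) c pp p∣X*1*c
    ... | inj₁ p∣X*1 = ∣m⇒∣m*n (2 * w)
          (prime∣m^k*n⇒∣m*n 3 a u pp (subst (p ∣_) (*-identityʳ X) p∣X*1))
    ... | inj₂ p∣c   = ∣n⇒∣m*n (3 * u)
          (prime∣m^k*n⇒∣m*n 2 (suc b) w pp (subst (p ∣_) 3^a*u+1≡2^[1+b]*w p∣c))

  D*2^b≡3u*c : D * 2 ^ b ≡ 3 * u * c
  D*2^b≡3u*c = trans (reassoc (3 * u) w (2 ^ b)) (cong (3 * u *_) (sym 3^a*u+1≡2^[1+b]*w))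
    where
    reassoc : ∀ x w y → x * (2 * w) * y ≡ x * (2 * y * w)
    reassoc = solve-∀

  radical-bound⇒2^[qj]≤[6[n+1]]^q*3^[pj] : ∀ p q → c ^ q ≤ rad (X * 1 * c) ^ (q + p) →
                                          2 ^ (q * j) ≤ (6 * (n + 1)) ^ q * 3 ^ (p * j)
  radical-bound⇒2^[qj]≤[6[n+1]]^q*3^[pj] p q c^q≤rad^[q+p] = begin
    2 ^ (q * j)                                 ≡⟨ cong (2 ^_) (*-comm q j) ⟩
    2 ^ (j * q)                                 ≡⟨ ^-*-assoc 2 j q ⟨
    (2 ^ j) ^ q                                 ≡⟨ cong (λ j → (2 ^ j) ^ q) j≡1+a+b ⟩
    (2 ^ (suc a + b)) ^ q                       ≡⟨ cong (_^ q) (^-distribˡ-+-* 2 (suc a) b) ⟩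
    (2 ^ suc a * 2 ^ b) ^ q                     ≡⟨ ^-distribʳ-* (2 ^ suc a) (2 ^ b) q ⟩
    (2 ^ suc a) ^ q * (2 ^ b) ^ q               ≤⟨ *-monoʳ-≤ ((2 ^ suc a) ^ q) 2^bq≤[3u]^q*c^p ⟩
    (2 ^ suc a) ^ q * ((3 * u) ^ q * c ^ p)     ≤⟨ *-monoʳ-≤ ((2 ^ suc a) ^ q)
                                                     (*-monoʳ-≤ ((3 * u) ^ q) (^-monoˡ-≤ p c≤3^j)) ⟩
    (2 ^ suc a) ^ q * ((3 * u) ^ q * (3 ^ j) ^ p) ≡⟨ *-assoc ((2 ^ suc a) ^ q) ((3 * u) ^ q) ((3 ^ j) ^ p) ⟨
    (2 ^ suc a) ^ q * (3 * u) ^ q * (3 ^ j) ^ p ≡⟨ cong₂ _*_ (^-distribʳ-* (2 ^ suc a) (3 * u) q) (sym 3^jp≡3^pj) ⟨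
    (2 ^ suc a * (3 * u)) ^ q * 3 ^ (p * j)     ≡⟨ cong (λ m → m ^ q * 3 ^ (p * j)) 2^[1+a]*3u≡6[n+1] ⟩
    (6 * (n + 1)) ^ q * 3 ^ (p * j)             ∎
    where
    open ≤-Reasoning
    rad≤D : rad (X * 1 * c) ≤ D
    rad≤D = ∣⇒≤ rad∣D
    2^bq≤[3u]^q*c^p : (2 ^ b) ^ q ≤ (3 * u) ^ q * c ^ p
    2^bq≤[3u]^q*c^p = c^q≤D^[q+p]⇒B^q≤U^q*c^p p q
      (≤-trans c^q≤rad^[q+p] (^-monoˡ-≤ (q + p) rad≤D)) D*2^b≡3u*c
    3^jp≡3^pj : (3 ^ j) ^ p ≡ 3 ^ (p * j)
    3^jp≡3^pj = trans (^-*-assoc 3 j p) (cong (3 ^_) (*-comm j p))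
    2^[1+a]*3u≡6[n+1] : 2 ^ suc a * (3 * u) ≡ 6 * (n + 1)
    2^[1+a]*3u≡6[n+1] = trans (regroup (2 ^ a) u) (cong (6 *_) (sym n+1≡2^a*u))
      where
      regroup : ∀ x u → 2 * x * (3 * u) ≡ 6 * (x * u)
      regroup = solve-∀

∈⇒≤sum : ∀ {m ms} → m ∈ ms → m ≤ sum ms
∈⇒≤sum (here refl)                 = m≤m+n _ _
∈⇒≤sum {ms = m′ ∷ _} (there m∈ms) = ≤-trans (∈⇒≤sum m∈ms) (m≤n+m _ m′)

lemma1 : ABC → ∀ (p q : ℕ) → 1 ≤ p → 1 ≤ q →
         ∃[ j₀ ] (∀ (j : ℕ) → j ≥ j₀ → 2 ≤ j → ∀ (n : ℕ) → InN j n →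
                  2 ^ (q * j) ≤ (6 * (n + 1)) ^ q * 3 ^ (p * j))
lemma1 abc p q 1≤p 1≤q with L , exceptional⇒∈L ← abc p q 1≤p 1≤q = S * S , bound
  where
  S = sum (map (proj₂ ∘ proj₂) L)
  bound : ∀ j → j ≥ S * S → 2 ≤ j → ∀ n → InN j n → 2 ^ (q * j) ≤ (6 * (n + 1)) ^ q * 3 ^ (p * j)
  bound j S*S≤j _ n n∈N@(_ , n<2^j , _) = radical-bound⇒2^[qj]≤[6[n+1]]^q*3^[pj] p q
    (≮⇒≥ λ exceptional → <⇒≱ (S*S≤j⇒S<c S S*S≤j) (c≤S exceptional))
    where
    open OddRunsBound (InN⇒TwoOddRuns {j} n∈N) n<2^j
    c≤S : rad (X * 1 * c) ^ (q + p) < c ^ q → c ≤ S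
    c≤S exceptional = ∈⇒≤sum (∈-map⁺ (proj₂ ∘ proj₂)
      (exceptional⇒∈L X 1 c 0<X z<s 0<c (Coprimality.sym (1-coprimeTo X))
                      (Coprimality.sym (coprime-+ (1-coprimeTo X))) (1-coprimeTo c) refl exceptional))
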